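{- Let $\alpha=(\alpha_1,\dots,\alpha_m)$ be a weak composition of $n\geq1$ and $1\leq k\leq m$. Then \[ p_\alpha^{(k)}(q)=\prod_{i=1}^k\binom{\alpha_1+\cdots+\alpha_i}{\alpha_i}_q\cdot\prod_{i=k+1}^m\binom{\alpha_1+\cdots+\alpha_i-1}{\alpha_i}_q. \]
   Context: $[j]_q=1+\dots+q^{j-1}$, $[a]_q!=[a]_q\cdots[1]_q$; $\binom{a}{b}_q=[a]_q!/([b]_q![a-b]_q!)$ for $0\leq b\leq a$ and $0$ otherwise; for $\beta\in\mathbb{Z}^m$ summing to $N$, $\binom{N}{\beta}_q=[N]_q!/\prod[\beta_i]_q!$ if all $\beta_i\geq0$, else $0$. $\mathrm{dec}_i\alpha$ is $\alpha$ with $\alpha_i$ decreased by $1$. The partial sum multinomial is $p_\alpha^{(k)}(q)=\sum_{i=1}^kq^{\alpha_1+\cdots+\alpha_{i-1}}\binom{n-1}{\mathrm{dec}_i\alpha}_q$; equivalently it is $\sum_w q^{\mathrm{inv}(w)}$ over words $w$ with $\alpha_j$ copies of each letter $j$ and first letter $w_1\leq k$. -}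

module Defs where

open import Data.Nat using (ℕ; zero; suc; _+_; _*_; _∸_; _^_; _≤_; _<_)
open import Data.Nat.DivMod using (_/_)
open import Data.Nat.Properties using (_≤?_)
open import Data.Fin using (Fin; toℕ; fromℕ<)
open import Data.Vec using (Vec; lookup; updateAt)
open import Relation.Nullary.Decidable using (does)
open import Data.Bool using (if_then_else_)

-- All q-quantities are evaluated at a natural number q.  A polynomial
-- identity in q with integer coefficients holds iff it holds at every q : ℕ.

[_]⟨_⟩ : ℕ → ℕ → ℕ
[ zero ]⟨ q ⟩ = 0
[ suc j ]⟨ q ⟩ = [ j ]⟨ q ⟩ + q ^ j

[_]!⟨_⟩ : ℕ → ℕ → ℕ
[ zero ]!⟨ q ⟩ = 1
[ suc a ]!⟨ q ⟩ = [ suc a ]⟨ q ⟩ * [ a ]!⟨ q ⟩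

-- Every [a]_q! with q : ℕ is nonzero (for q = 0 all [j]_0 = 1, j ≥ 1),
-- so division in ℕ is well defined; it is exact since q-binomials are
-- polynomials with integer coefficients.  The divisor is written as
-- suc (d ∸ 1), which equals d since d ≥ 1.
_÷_ : ℕ → ℕ → ℕ
a ÷ d = a / suc (d ∸ 1)

qbinom : ℕ → ℕ → ℕ → ℕ
qbinom q a b = if does (b ≤? a)
               then [ a ]!⟨ q ⟩ ÷ ([ b ]!⟨ q ⟩ * [ a ∸ b ]!⟨ q ⟩)
               else 0

-- binom(a-1, b)_q with a-1 taken in ℤ: when a = 0 the top is -1 < 0 ≤ b,
-- so the value is 0 by the "0 otherwise" convention.
qbinomPred : ℕ → ℕ → ℕ → ℕ
qbinomPred q zero b = 0
qbinomPred q (suc a) b = qbinom q a b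

sumFin : ∀ m → (Fin m → ℕ) → ℕ
sumFin zero f = 0
sumFin (suc m) f = f Fin.zero + sumFin m (λ i → f (Fin.suc i))
  where import Data.Fin as Fin

prodFin : ∀ m → (Fin m → ℕ) → ℕ
prodFin zero f = 1
prodFin (suc m) f = f Fin.zero * prodFin m (λ i → f (Fin.suc i))
  where import Data.Fin as Fin

qmultinom : ∀ {m} → ℕ → ℕ → Vec ℕ m → ℕ
qmultinom {m} q N β = [ N ]!⟨ q ⟩ ÷ prodFin m (λ i → [ lookup β i ]!⟨ q ⟩)

vsum : ∀ {m} → Vec ℕ m → ℕ
vsum {m} α = sumFin m (lookup α)

-- α_1 + ... + α_i  (1-indexed i; the first i entries); partialSum α i
partialSum : ∀ {m} → Vec ℕ m → ℕ → ℕ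
partialSum {m} α i = sumFin m (λ j → if does (suc (toℕ j) ≤? i) then lookup α j else 0)

-- q-multinomial binom(n-1, dec_i α): 0 if α_i = 0 (a negative part)
qmultinomDec : ∀ {m} → ℕ → ℕ → Vec ℕ m → Fin m → ℕ
qmultinomDec q N α i with lookup α i
... | zero = 0
... | suc _ = qmultinom q N (updateAt α i (λ x → x ∸ 1))

-- partial sum multinomial
--   p_α^(k)(q) = ∑_{i=1}^k q^(α_1+...+α_{i-1}) binom(n-1, dec_i α)_q
-- where n = α_1 + ... + α_m.  (0-indexed j corresponds to i = j+1.)
pPartial : ∀ {m} → ℕ → Vec ℕ m → ℕ → ℕ
pPartial {m} q α k =
  sumFin m (λ j → if does (suc (toℕ j) ≤? k)
                  then q ^ partialSum α (toℕ j) * qmultinomDec q (vsum α ∸ 1) α j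
                  else 0)

rhs : ∀ {m} → ℕ → Vec ℕ m → ℕ → ℕ
rhs {m} q α k =
  prodFin m (λ j → if does (suc (toℕ j) ≤? k)
                   then qbinom q (partialSum α (suc (toℕ j))) (lookup α j)
                   else qbinomPred q (partialSum α (suc (toℕ j))) (lookup α j))

{-# OPTIONS --safe #-}
-- Multiply both sides by ∏ [α_i]! and write s_i = α_1 + ⋯ + α_i.  On the left,
-- binom(n-1, dec_i α)·∏ [α_j]! = [n-1]!·[α_i], and [s + a] = [s] + q^s [a] makes
-- Σ_{i≤k} q^{s_{i-1}} [α_i] telescope to [s_k].  On the right, binom(s_i, α_i)·[α_i]! =
-- [s_i]!/[s_{i-1}]! and binom(s_i - 1, α_i)·[α_i]! = [s_i - 1]!/[s_{i-1} - 1]! telescope to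
-- [s_k]!·[n-1]!/[s_k - 1]! = [n-1]!·[s_k], unless s_k = 0, in which case the factor
-- binom(α_{k+1} - 1, α_{k+1}) vanishes.  The division in ℕ is exact because the q-Pascal
-- recursion exhibits [a]!·[b]! as a divisor of [a+b]!.
module Submission where

open import Data.Bool using (Bool; false; if_then_else_)
open import Function using (_∘_)
open import Data.Fin using (Fin; toℕ) renaming (zero to fzero; suc to fsuc)
open import Data.Nat using (ℕ; zero; suc; _+_; _*_; _∸_; _^_; _≤_; _<_; s≤s; z<s; NonZero; >-nonZero)
open import Data.Nat.Divisibility using (_∣_; divides; ∣-refl; ∣-trans; *-monoʳ-∣)
open import Data.Nat.DivMod using (m/n*n≡m)
open import Data.Nat.Properties
open import Data.Nat.Solver using (module +-*-Solver)
open import Data.Vec using (Vec; []; _∷_; lookup; updateAt)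
open import Relation.Binary.PropositionalEquality
  using (_≡_; refl; sym; trans; cong; cong₂; subst; module ≡-Reasoning)
open import Algebra.Properties.CommutativeSemigroup *-commutativeSemigroup using (x∙yz≈y∙xz)
open import Relation.Nullary.Decidable using (does; dec-true; dec-false)

open import Defs

open +-*-Solver

m÷n*n≡m : ∀ {m n} .{{_ : NonZero n}} → n ∣ m → m ÷ n * n ≡ m
m÷n*n≡m {n = suc n} n∣m = m/n*n≡m n∣m

sumFin-cong : ∀ m {f g : Fin m → ℕ} → (∀ j → f j ≡ g j) → sumFin m f ≡ sumFin m g
sumFin-cong zero    f≗g = refl
sumFin-cong (suc m) f≗g = cong₂ _+_ (f≗g fzero) (sumFin-cong m (f≗g ∘ fsuc))

prodFin-cong : ∀ m {f g : Fin m → ℕ} → (∀ j → f j ≡ g j) → prodFin m f ≡ prodFin m g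
prodFin-cong zero    f≗g = refl
prodFin-cong (suc m) f≗g = cong₂ _*_ (f≗g fzero) (prodFin-cong m (λ j → f≗g (fsuc j)))

-- partialSum α k and pPartial q α k are, definitionally, of the form sumTo k f.
sumTo : ∀ {m} → ℕ → (Fin m → ℕ) → ℕ
sumTo {m} k f = sumFin m (λ j → if does (suc (toℕ j) ≤? k) then f j else 0)

sumTo-zero : ∀ {m} (f : Fin m → ℕ) → sumTo 0 f ≡ 0
sumTo-zero {zero}  f = refl
sumTo-zero {suc m} f = sumTo-zero (f ∘ fsuc)

sumTo-cong : ∀ {m} k {f g : Fin m → ℕ} → (∀ j → f j ≡ g j) → sumTo k f ≡ sumTo k g
sumTo-cong {m} k f≗g =
  sumFin-cong m (λ j → cong (λ x → if does (suc (toℕ j) ≤? k) then x else 0) (f≗g j))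

sumTo-*ˡ : ∀ {m} c k (f : Fin m → ℕ) → c * sumTo k f ≡ sumTo k (λ j → c * f j)
sumTo-*ˡ {zero}  c k       f = *-zeroʳ c
sumTo-*ˡ {suc m} c zero    f = begin
  c * sumTo 0 f                ≡⟨ cong (c *_) (sumTo-zero f) ⟩
  c * 0                        ≡⟨ *-zeroʳ c ⟩
  0                            ≡⟨ sumTo-zero (λ j → c * f j) ⟨
  sumTo 0 (λ j → c * f j)      ∎
  where open ≡-Reasoning
sumTo-*ˡ {suc m} c (suc k) f =
  trans (*-distribˡ-+ c (f fzero) _) (cong (c * f fzero +_) (sumTo-*ˡ c k (f ∘ fsuc)))

partialSum-zero : ∀ {m} (α : Vec ℕ m) → partialSum α 0 ≡ 0
partialSum-zero α = sumTo-zero (lookup α)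

+-partialSum-zero : ∀ {m} t (α : Vec ℕ m) → t + partialSum α 0 ≡ t
+-partialSum-zero t α = trans (cong (t +_) (partialSum-zero α)) (+-identityʳ t)

partialSum-all : ∀ {m} (α : Vec ℕ m) → partialSum α m ≡ vsum α
partialSum-all []      = refl
partialSum-all (a ∷ α) = cong (a +_) (partialSum-all α)

module _ (q : ℕ) where

  [_] : ℕ → ℕ
  [ n ] = [ n ]⟨ q ⟩

  [_]! : ℕ → ℕ
  [ n ]! = [ n ]!⟨ q ⟩

  qint-+ : ∀ m n → [ m + n ] ≡ [ m ] + q ^ m * [ n ]
  qint-+ m zero = begin
    [ m + 0 ]          ≡⟨ cong [_] (+-identityʳ m) ⟩
    [ m ]              ≡⟨ +-identityʳ [ m ] ⟨
    [ m ] + 0          ≡⟨ cong ([ m ] +_) (*-zeroʳ (q ^ m)) ⟨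
    [ m ] + q ^ m * 0  ∎
    where open ≡-Reasoning
  qint-+ m (suc n) = begin
    [ m + suc n ]                            ≡⟨ cong [_] (+-suc m n) ⟩
    [ m + n ] + q ^ (m + n)                  ≡⟨ cong₂ _+_ (qint-+ m n) (^-distribˡ-+-* q m n) ⟩
    [ m ] + q ^ m * [ n ] + q ^ m * q ^ n    ≡⟨ +-assoc [ m ] _ _ ⟩
    [ m ] + (q ^ m * [ n ] + q ^ m * q ^ n)  ≡⟨ cong ([ m ] +_) (*-distribˡ-+ (q ^ m) [ n ] (q ^ n)) ⟨
    [ m ] + q ^ m * [ suc n ]                ∎
    where open ≡-Reasoning

  qint-suc>0 : ∀ n → 0 < [ suc n ]
  qint-suc>0 zero    = z<s
  qint-suc>0 (suc n) = ≤-trans (qint-suc>0 n) (m≤m+n [ suc n ] (q ^ suc n))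

  qfact≢0 : ∀ n → NonZero [ n ]!
  qfact≢0 zero    = _
  qfact≢0 (suc n) = m*n≢0 [ suc n ] [ n ]! {{>-nonZero (qint-suc>0 n)}} {{qfact≢0 n}}

  qPascal : ℕ → ℕ → ℕ
  qPascal zero    n       = 1
  qPascal (suc m) zero    = 1
  qPascal (suc m) (suc n) = qPascal m (suc n) + q ^ suc m * qPascal (suc m) n

  qPascal-*-qfacts : ∀ m n → qPascal m n * ([ m ]! * [ n ]!) ≡ [ m + n ]!
  qPascal-*-qfacts zero    n    = trans (*-identityˡ _) (*-identityˡ [ n ]!)
  qPascal-*-qfacts (suc m) zero = begin
    1 * ([ suc m ]! * 1)  ≡⟨ *-identityˡ _ ⟩
    [ suc m ]! * 1        ≡⟨ *-identityʳ _ ⟩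
    [ suc m ]!            ≡⟨ cong [_]! (+-identityʳ (suc m)) ⟨
    [ suc m + 0 ]!        ∎
    where open ≡-Reasoning
  qPascal-*-qfacts (suc m) (suc n) = begin
    (P₁ + Q * P₂) * (([ suc m ] * [ m ]!) * ([ suc n ] * [ n ]!))
      ≡⟨ solve 7 (λ p₁ Q p₂ M m! N n! → (p₁ :+ Q :* p₂) :* ((M :* m!) :* (N :* n!))
                    := M :* (p₁ :* (m! :* (N :* n!))) :+ Q :* N :* (p₂ :* ((M :* m!) :* n!)))
                 refl P₁ Q P₂ [ suc m ] [ m ]! [ suc n ] [ n ]! ⟩
    [ suc m ] * (P₁ * ([ m ]! * [ suc n ]!)) + Q * [ suc n ] * (P₂ * ([ suc m ]! * [ n ]!))
      ≡⟨ cong₂ (λ x y → [ suc m ] * x + Q * [ suc n ] * y)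
               (qPascal-*-qfacts m (suc n))
               (trans (qPascal-*-qfacts (suc m) n) (cong [_]! (sym (+-suc m n)))) ⟩
    [ suc m ] * [ m + suc n ]! + Q * [ suc n ] * [ m + suc n ]!
      ≡⟨ *-distribʳ-+ [ m + suc n ]! [ suc m ] (Q * [ suc n ]) ⟨
    ([ suc m ] + Q * [ suc n ]) * [ m + suc n ]!
      ≡⟨ cong (_* [ m + suc n ]!) (qint-+ (suc m) (suc n)) ⟨
    [ suc m + suc n ]!
      ∎
    where
      open ≡-Reasoning
      P₁ = qPascal m (suc n)
      P₂ = qPascal (suc m) n
      Q = q ^ suc m

  qfacts-∣ : ∀ m n → [ m ]! * [ n ]! ∣ [ m + n ]!
  qfacts-∣ m n = divides (qPascal m n) (sym (qPascal-*-qfacts m n))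

  qbinom-*-qfacts : ∀ m n → qbinom q (n + m) m * ([ m ]! * [ n ]!) ≡ [ n + m ]!
  qbinom-*-qfacts m n rewrite dec-true (m ≤? n + m) (m≤n+m m n) | m+n∸n≡m n m =
    m÷n*n≡m {{m*n≢0 [ m ]! [ n ]! {{qfact≢0 m}} {{qfact≢0 n}}}}
            (subst ([ m ]! * [ n ]! ∣_) (cong [_]! (+-comm m n)) (qfacts-∣ m n))

  qbinom-< : ∀ {m n} → m < n → qbinom q m n ≡ 0
  qbinom-< {m} {n} m<n rewrite dec-false (n ≤? m) (<⇒≱ m<n) = refl

  qbinomPred-diag : ∀ n → qbinomPred q n n ≡ 0
  qbinomPred-diag zero    = refl
  qbinomPred-diag (suc n) = qbinom-< (n<1+n n)

  qfactProd : ∀ {m} → Vec ℕ m → ℕ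
  qfactProd {m} α = prodFin m (λ i → [ lookup α i ]!)

  qfactProd≢0 : ∀ {m} (α : Vec ℕ m) → NonZero (qfactProd α)
  qfactProd≢0 []      = _
  qfactProd≢0 (a ∷ α) = m*n≢0 [ a ]! (qfactProd α) {{qfact≢0 a}} {{qfactProd≢0 α}}

  qfactProd-∣ : ∀ {m} (α : Vec ℕ m) → qfactProd α ∣ [ vsum α ]!
  qfactProd-∣ []      = ∣-refl
  qfactProd-∣ (a ∷ α) = ∣-trans (*-monoʳ-∣ [ a ]! (qfactProd-∣ α)) (qfacts-∣ a (vsum α))

  qmultinom-*-qfactProd : ∀ {m} (α : Vec ℕ m) →
                          qmultinom q (vsum α) α * qfactProd α ≡ [ vsum α ]!
  qmultinom-*-qfactProd α = m÷n*n≡m {{qfactProd≢0 α}} (qfactProd-∣ α)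

  vsum-decrement : ∀ {m} (α : Vec ℕ m) j {n} → lookup α j ≡ suc n →
                   vsum α ≡ suc (vsum (updateAt α j (_∸ 1)))
  vsum-decrement (a ∷ α) fzero    refl = refl
  vsum-decrement (a ∷ α) (fsuc j) αⱼ≡1+n =
    trans (cong (a +_) (vsum-decrement α j αⱼ≡1+n)) (+-suc a _)

  qfactProd-decrement : ∀ {m} (α : Vec ℕ m) j {n} → lookup α j ≡ suc n →
                        qfactProd α ≡ [ suc n ] * qfactProd (updateAt α j (_∸ 1))
  qfactProd-decrement (a ∷ α) fzero    {n} refl = *-assoc [ suc n ] [ n ]! _
  qfactProd-decrement (a ∷ α) (fsuc j) {n} αⱼ≡1+n =
    trans (cong ([ a ]! *_) (qfactProd-decrement α j αⱼ≡1+n)) (x∙yz≈y∙xz [ a ]! [ suc n ] _)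

  qmultinomDec-*-qfactProd : ∀ {m} (α : Vec ℕ m) j →
    qmultinomDec q (vsum α ∸ 1) α j * qfactProd α ≡ [ vsum α ∸ 1 ]! * [ lookup α j ]
  qmultinomDec-*-qfactProd α j with lookup α j in αⱼ≡
  ... | zero  = sym (*-zeroʳ [ vsum α ∸ 1 ]!)
  ... | suc n = begin
    qmultinom q (vsum α ∸ 1) α′ * qfactProd α
      ≡⟨ cong₂ (λ s p → qmultinom q s α′ * p) vsum′ (qfactProd-decrement α j αⱼ≡) ⟩
    qmultinom q (vsum α′) α′ * ([ suc n ] * qfactProd α′)
      ≡⟨ x∙yz≈y∙xz (qmultinom q (vsum α′) α′) [ suc n ] (qfactProd α′) ⟩
    [ suc n ] * (qmultinom q (vsum α′) α′ * qfactProd α′)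
      ≡⟨ cong ([ suc n ] *_) (qmultinom-*-qfactProd α′) ⟩
    [ suc n ] * [ vsum α′ ]!
      ≡⟨ *-comm [ suc n ] _ ⟩
    [ vsum α′ ]! * [ suc n ]
      ≡⟨ cong (λ s → [ s ]! * [ suc n ]) vsum′ ⟨
    [ vsum α ∸ 1 ]! * [ suc n ]
      ∎
    where
      open ≡-Reasoning
      α′ = updateAt α j (_∸ 1)
      vsum′ : vsum α ∸ 1 ≡ vsum α′
      vsum′ = cong (_∸ 1) (vsum-decrement α j αⱼ≡)

  sumTo-qint : ∀ {m} (α : Vec ℕ m) k →
               sumTo k (λ j → q ^ partialSum α (toℕ j) * [ lookup α j ]) ≡ [ partialSum α k ]
  sumTo-qint []      k    = refl
  sumTo-qint {suc m} (a ∷ α) zero =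
    trans (sumTo-zero (λ j → q ^ partialSum (a ∷ α) (toℕ j) * [ lookup (a ∷ α) j ]))
          (cong [_] (sym (partialSum-zero (a ∷ α))))
  sumTo-qint {suc m} (a ∷ α) (suc k) = begin
    q ^ partialSum (a ∷ α) 0 * [ a ] + sumTo k (λ j → q ^ (a + s j) * [ lookup α j ])
      ≡⟨ cong₂ _+_ head tail ⟩
    [ a ] + q ^ a * sumTo k (λ j → q ^ s j * [ lookup α j ])
      ≡⟨ cong (λ x → [ a ] + q ^ a * x) (sumTo-qint α k) ⟩
    [ a ] + q ^ a * [ partialSum α k ]
      ≡⟨ qint-+ a (partialSum α k) ⟨
    [ a + partialSum α k ]
      ∎
    where
      open ≡-Reasoning
      s : Fin m → ℕ
      s j = partialSum α (toℕ j)
      head : q ^ partialSum (a ∷ α) 0 * [ a ] ≡ [ a ]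
      head = trans (cong (λ e → q ^ e * [ a ]) (partialSum-zero (a ∷ α))) (*-identityˡ [ a ])
      tail : sumTo k (λ j → q ^ (a + s j) * [ lookup α j ])
           ≡ q ^ a * sumTo k (λ j → q ^ s j * [ lookup α j ])
      tail = trans (sumTo-cong k (λ j → trans (cong (_* [ lookup α j ]) (^-distribˡ-+-* q a (s j)))
                                              (*-assoc (q ^ a) (q ^ s j) [ lookup α j ])))
                   (sym (sumTo-*ˡ {m} (q ^ a) k _))

  pPartial-*-qfactProd : ∀ {m} (α : Vec ℕ m) k →
                         pPartial q α k * qfactProd α ≡ [ vsum α ∸ 1 ]! * [ partialSum α k ]
  pPartial-*-qfactProd {m} α k = begin
    pPartial q α k * qfactProd α
      ≡⟨ *-comm (pPartial q α k) P ⟩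
    P * sumTo k (λ j → q ^ s j * qmultinomDec q (vsum α ∸ 1) α j)
      ≡⟨ sumTo-*ˡ {m} P k _ ⟩
    sumTo k (λ j → P * (q ^ s j * qmultinomDec q (vsum α ∸ 1) α j))
      ≡⟨ sumTo-cong k termwise ⟩
    sumTo k (λ j → [ vsum α ∸ 1 ]! * (q ^ s j * [ lookup α j ]))
      ≡⟨ sumTo-*ˡ {m} [ vsum α ∸ 1 ]! k _ ⟨
    [ vsum α ∸ 1 ]! * sumTo k (λ j → q ^ s j * [ lookup α j ])
      ≡⟨ cong ([ vsum α ∸ 1 ]! *_) (sumTo-qint α k) ⟩
    [ vsum α ∸ 1 ]! * [ partialSum α k ]
      ∎
    where
      open ≡-Reasoning
      P = qfactProd α
      s : Fin m → ℕ
      s j = partialSum α (toℕ j)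
      termwise : ∀ j → P * (q ^ s j * qmultinomDec q (vsum α ∸ 1) α j)
                     ≡ [ vsum α ∸ 1 ]! * (q ^ s j * [ lookup α j ])
      termwise j = begin
        P * (q ^ s j * D)                  ≡⟨ x∙yz≈y∙xz P (q ^ s j) D ⟩
        q ^ s j * (P * D)                  ≡⟨ cong (q ^ s j *_) (*-comm P D) ⟩
        q ^ s j * (D * P)                  ≡⟨ cong (q ^ s j *_) (qmultinomDec-*-qfactProd α j) ⟩
        q ^ s j * ([ vsum α ∸ 1 ]! * [ lookup α j ])
          ≡⟨ x∙yz≈y∙xz (q ^ s j) [ vsum α ∸ 1 ]! [ lookup α j ] ⟩
        [ vsum α ∸ 1 ]! * (q ^ s j * [ lookup α j ])  ∎
        where D = qmultinomDec q (vsum α ∸ 1) α j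

  rhsFactor : Bool → ℕ → ℕ → ℕ
  rhsFactor b s a = if b then qbinom q s a else qbinomPred q s a

  -- rhs for α preceded by entries summing to t; rhs q α k is rhsFrom 0 α k.
  rhsFrom : ∀ {m} → ℕ → Vec ℕ m → ℕ → ℕ
  rhsFrom {m} t α k = prodFin m (λ j → rhsFactor (does (suc (toℕ j) ≤? k))
                                                 (t + partialSum α (suc (toℕ j))) (lookup α j))

  rhsFrom-∷ : ∀ {m} t a (α : Vec ℕ m) k →
              rhsFrom t (a ∷ α) k ≡ rhsFactor (does (1 ≤? k)) (t + a) a * rhsFrom (t + a) α (k ∸ 1)
  rhsFrom-∷ {m} t a α k =
    cong₂ _*_ (cong (λ s → rhsFactor (does (1 ≤? k)) s a) (cong (t +_) (+-partialSum-zero a α))) (tail k)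
    where
      shift : ∀ b j → rhsFactor b (t + (a + partialSum α (suc (toℕ j)))) (lookup α j)
                    ≡ rhsFactor b (t + a + partialSum α (suc (toℕ j))) (lookup α j)
      shift b j = cong (λ s → rhsFactor b s (lookup α j)) (sym (+-assoc t a _))
      tail : ∀ k → prodFin m (λ j → rhsFactor (does (2 + toℕ j ≤? k))
                                              (t + (a + partialSum α (suc (toℕ j)))) (lookup α j))
                 ≡ rhsFrom (t + a) α (k ∸ 1)
      tail zero    = prodFin-cong m (shift false)
      tail (suc k) = prodFin-cong m (λ j → shift (does (suc (toℕ j) ≤? k)) j)

  rhsFrom-vanishes : ∀ {m} t (α : Vec ℕ m) k → k < m → t + partialSum α k ≡ 0 →
                     rhsFrom t α k ≡ 0
  rhsFrom-vanishes t (a ∷ α) zero _ t+s₀≡0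
    with refl ← trans (sym (+-partialSum-zero t (a ∷ α))) t+s₀≡0 =
    trans (rhsFrom-∷ 0 a α 0) (cong (_* rhsFrom a α 0) (qbinomPred-diag a))
  rhsFrom-vanishes t (a ∷ α) (suc k) (s≤s k<m) t+sₖ≡0 = begin
    rhsFrom t (a ∷ α) (suc k)                   ≡⟨ rhsFrom-∷ t a α (suc k) ⟩
    qbinom q (t + a) a * rhsFrom (t + a) α k    ≡⟨ cong (qbinom q (t + a) a *_) tail≡0 ⟩
    qbinom q (t + a) a * 0                      ≡⟨ *-zeroʳ (qbinom q (t + a) a) ⟩
    0                                           ∎
    where
      open ≡-Reasoning
      tail≡0 = rhsFrom-vanishes (t + a) α k k<m (trans (+-assoc t a _) t+sₖ≡0)

  rhsFrom-below : ∀ {m} u (α : Vec ℕ m) →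
                  rhsFrom (suc u) α 0 * qfactProd α * [ u ]! ≡ [ u + vsum α ]!
  rhsFrom-below u []      = trans (*-identityˡ [ u ]!) (cong [_]! (sym (+-identityʳ u)))
  rhsFrom-below u (a ∷ α) = begin
    rhsFrom (suc u) (a ∷ α) 0 * ([ a ]! * P) * [ u ]!
      ≡⟨ cong (λ x → x * ([ a ]! * P) * [ u ]!) (rhsFrom-∷ (suc u) a α 0) ⟩
    B * R * ([ a ]! * P) * [ u ]!
      ≡⟨ solve 5 (λ B R A P U → B :* R :* (A :* P) :* U := R :* P :* (B :* (A :* U)))
                 refl B R [ a ]! P [ u ]! ⟩
    R * P * (B * ([ a ]! * [ u ]!))
      ≡⟨ cong (R * P *_) (qbinom-*-qfacts a u) ⟩
    R * P * [ u + a ]!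
      ≡⟨ rhsFrom-below (u + a) α ⟩
    [ u + a + vsum α ]!
      ≡⟨ cong [_]! (+-assoc u a (vsum α)) ⟩
    [ u + (a + vsum α) ]!
      ∎
    where
      open ≡-Reasoning
      B = qbinom q (u + a) a
      R = rhsFrom (suc (u + a)) α 0
      P = qfactProd α

  rhsFrom-above : ∀ {m} t (α : Vec ℕ m) k {u} → t + partialSum α k ≡ suc u →
                  rhsFrom t α k * qfactProd α * [ t ]! * [ u ]! ≡ [ suc u ]! * [ t + vsum α ∸ 1 ]!
  rhsFrom-above t α zero {u} t+s₀≡1+u with refl ← trans (sym (+-partialSum-zero t α)) t+s₀≡1+u =
    trans (solve 4 (λ R P F U → R :* P :* F :* U := F :* (R :* P :* U)) refl
                   (rhsFrom (suc u) α 0) (qfactProd α) [ suc u ]! [ u ]!)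
          (cong ([ suc u ]! *_) (rhsFrom-below u α))
  rhsFrom-above t [] (suc k) t+sₖ≡1+u = rhsFrom-above t [] zero t+sₖ≡1+u
  rhsFrom-above t (a ∷ α) (suc k) {u} t+sₖ≡1+u = begin
    rhsFrom t (a ∷ α) (suc k) * ([ a ]! * P) * [ t ]! * [ u ]!
      ≡⟨ cong (λ x → x * ([ a ]! * P) * [ t ]! * [ u ]!) (rhsFrom-∷ t a α (suc k)) ⟩
    B * R * ([ a ]! * P) * [ t ]! * [ u ]!
      ≡⟨ solve 6 (λ B R A P T U → B :* R :* (A :* P) :* T :* U := R :* P :* (B :* (A :* T)) :* U)
                 refl B R [ a ]! P [ t ]! [ u ]! ⟩
    R * P * (B * ([ a ]! * [ t ]!)) * [ u ]!
      ≡⟨ cong (λ x → R * P * x * [ u ]!) (qbinom-*-qfacts a t) ⟩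
    R * P * [ t + a ]! * [ u ]!
      ≡⟨ rhsFrom-above (t + a) α k (trans (+-assoc t a _) t+sₖ≡1+u) ⟩
    [ suc u ]! * [ t + a + vsum α ∸ 1 ]!
      ≡⟨ cong (λ s → [ suc u ]! * [ s ∸ 1 ]!) (+-assoc t a (vsum α)) ⟩
    [ suc u ]! * [ t + (a + vsum α) ∸ 1 ]!
      ∎
    where
      open ≡-Reasoning
      B = qbinom q (t + a) a
      R = rhsFrom (t + a) α k
      P = qfactProd α

  rhs-*-qfactProd : ∀ {m} (α : Vec ℕ m) k → 1 ≤ vsum α → k ≤ m →
                    rhs q α k * qfactProd α ≡ [ vsum α ∸ 1 ]! * [ partialSum α k ]
  rhs-*-qfactProd {m} α k 1≤n k≤m with partialSum α k in sₖ≡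
  ... | zero  = trans (cong (_* qfactProd α) (rhsFrom-vanishes 0 α k k<m sₖ≡))
                      (sym (*-zeroʳ [ vsum α ∸ 1 ]!))
    where
      k<m : k < m
      k<m = ≤∧≢⇒< k≤m (λ { refl → m<n⇒n≢0 1≤n (trans (sym (partialSum-all α)) sₖ≡) })
  ... | suc u = *-cancelʳ-≡ _ _ [ u ]! {{qfact≢0 u}} (begin
    rhs q α k * qfactProd α * [ u ]!
      ≡⟨ cong (_* [ u ]!) (*-identityʳ (rhs q α k * qfactProd α)) ⟨
    rhsFrom 0 α k * qfactProd α * [ 0 ]! * [ u ]!
      ≡⟨ rhsFrom-above 0 α k sₖ≡ ⟩
    ([ suc u ] * [ u ]!) * [ vsum α ∸ 1 ]!
      ≡⟨ solve 3 (λ S U N → S :* U :* N := N :* S :* U) refl [ suc u ] [ u ]! [ vsum α ∸ 1 ]! ⟩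
    [ vsum α ∸ 1 ]! * [ suc u ] * [ u ]!
      ∎)
    where open ≡-Reasoning

lemma7p9 : (m n k : ℕ) (α : Vec ℕ m) → vsum α ≡ n → 1 ≤ n →
           1 ≤ k → k ≤ m → (q : ℕ) →
           pPartial q α k ≡ rhs q α k
-- Both sides vanish when k = 0.
lemma7p9 m n k α refl 1≤n _ k≤m q =
  *-cancelʳ-≡ _ _ (qfactProd q α) {{qfactProd≢0 q α}}
    (trans (pPartial-*-qfactProd q α k) (sym (rhs-*-qfactProd q α k 1≤n k≤m)))
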